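{- Let $G$ be a colored graph with colors $\{0,\dots,d\}$ and $H\subset G$ a colored subgraph with free vertices $v_1,\dots,v_k$; let $e_1,\dots,e_k$ be the edges of color 0 of $G$ incident to $v_1,\dots,v_k$. Let $G_{/H}$ be the graph obtained from $G$ by replacing $H$ with its boundary bubble $\partial H$ (keeping the names $v_1,\dots,v_k$ for the vertices of $\partial H$ and $e_1,\dots,e_k$ for their incident color-0 edges). Then for every pair $i,j$, $I_G(e_i,e_j)=I_{G_{/H}}(e_i,e_j)$.
   Context: A colored graph with colors $\{0,\dots,d\}$ is a finite connected bipartite graph (black/white vertices, multiple edges allowed) in which each edge carries a color in $\{0,\dots,d\}$ and each vertex has exactly one incident edge of each color. A colored subgraph $H\subset G$ is a connected subgraph in which every vertex has incident edges of all colors $1,\dots,d$ (in $H$); its free vertices are those with no incident edge of color 0 in $H$. The boundary bubble $\partial H$ has the free vertices of $H$ as vertices, and an edge of color $c\in\{1,\dots,d\}$ between two of them whenever $H$ contains an open path alternating colors $0$ and $c$ joining these two free vertices. A bicolored cycle with colors $\{a,b\}$ is a connected component of the subgraph of edges of colors $a,b$. For color-0 edges $e,e'$, $I_G(e,e')\subset\{1,\dots,d\}$ is the set of colors $c$ such that the same bicolored cycle with colors $\{0,c\}$ passes along both $e$ and $e'$. -}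

module Defs where

open import Data.Nat using (ℕ; zero; suc)
open import Data.Fin using (Fin; zero; suc)
open import Data.Sum using (_⊎_; inj₁; inj₂)
open import Data.Product using (Σ; ∃; _×_; _,_)
open import Data.Unit using (⊤)
open import Data.Empty using (⊥)
open import Data.Bool using (Bool; true; false; not)
open import Relation.Nullary using (¬_)
open import Relation.Binary.PropositionalEquality using (_≡_)
open import Relation.Binary.Construct.Closure.ReflexiveTransitive using (Star)
open import Function.Definitions using (Bijective; Injective)

-- Colors {0,…,d} are Fin (suc d); color 0 is `zero`, colors 1…d are `suc c` with c : Fin d.
Color : ℕ → Set
Color d = Fin (suc d)

-- A colored graph with colors {0,…,d}: n black vertices and n white vertices
-- (both indexed by Fin n).  Since every vertex has exactly one incident edge
-- of each color, the edges of color a form a perfect matching, encoded as a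
-- bijection σ a from black to white vertices; the edge of color a incident to
-- black vertex b is identified with the pair (a , b) and joins b to σ a b.
-- Multiple edges are allowed (σ a b ≡ σ a' b for a ≢ a').
-- Connectedness is a separate predicate (`Connected`), so that graphs obtained
-- by contraction are not forced to be connected.
record ColGraph (d : ℕ) : Set where
  field
    n     : ℕ
    σ     : Color d → Fin n → Fin n
    σ-bij : ∀ a → Bijective _≡_ _≡_ (σ a)

module _ {d : ℕ} (G : ColGraph d) where
  open ColGraph G

  -- inj₁ = black vertex, inj₂ = white vertex
  Vertex : Set
  Vertex = Fin n ⊎ Fin n

  Adj : (Color d → Fin n → Set) → Vertex → Vertex → Set
  Adj E (inj₁ b) (inj₂ w) = Σ (Color d) λ a → E a b × σ a b ≡ w
  Adj E (inj₂ w) (inj₁ b) = Σ (Color d) λ a → E a b × σ a b ≡ w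
  Adj E (inj₁ _) (inj₁ _) = ⊥
  Adj E (inj₂ _) (inj₂ _) = ⊥

  Reach : (Color d → Set) → Vertex → Vertex → Set
  Reach P = Star (Adj (λ a _ → P a))

  Connected : Set
  Connected = ∀ v w → Reach (λ _ → ⊤) v w

  -- c ∈ I_G(e , e') for the color-0 edges e = (0 , b), e' = (0 , b') and
  -- color suc c ∈ {1,…,d}: e and e' lie in the same connected component of
  -- the subgraph of edges of colors {0 , suc c} (the bicolored cycle).
  InI : Fin n → Fin n → Fin d → Set
  InI b b' c = Reach (λ a → a ≡ zero ⊎ a ≡ suc c) (inj₁ b) (inj₁ b')

  record ColSubgraph : Set₁ where
    field
      inV        : Vertex → Set
      inE        : Color d → Fin n → Set
      edge-ends  : ∀ a b → inE a b → inV (inj₁ b) × inV (inj₂ (σ a b))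
      full-black : ∀ b (c : Fin d) → inV (inj₁ b) → inE (suc c) b
      full-white : ∀ b (c : Fin d) → inV (inj₂ (σ (suc c) b)) → inE (suc c) b
      connected  : ∀ v w → inV v → inV w → Star (Adj inE) v w

module _ {d : ℕ} {G : ColGraph d} (H : ColSubgraph G) where
  open ColGraph G
  open ColSubgraph H

  Has0 : Vertex G → Set
  Has0 (inj₁ b) = inE zero b
  Has0 (inj₂ w) = Σ (Fin n) λ b → σ zero b ≡ w × inE zero b

  Free : Vertex G → Set
  Free v = inV v × ¬ Has0 v

  HEdge : Color d → Vertex G → Vertex G → Set
  HEdge a = Adj G (λ a' b → a' ≡ a × inE a' b)

  -- Walks in H alternating colors 0 and suc c; the Bool says whether the
  -- first edge has color suc c (true) or 0 (false).  Nonempty.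
  col : Fin d → Bool → Color d
  col c true  = suc c
  col c false = zero

  data Alt (c : Fin d) : Bool → Vertex G → Vertex G → Set where
    one  : ∀ {t v w}   → HEdge (col c t) v w → Alt c t v w
    cons : ∀ {t v u w} → HEdge (col c t) v u → Alt c (not t) u w → Alt c t v w

  -- edge of color suc c of the boundary bubble ∂H between free vertices v, w:
  -- an open path in H alternating colors 0 and suc c joins them (it
  -- necessarily starts with color suc c since v has no color-0 edge in H).
  BoundaryEdge : Fin d → Vertex G → Vertex G → Set
  BoundaryEdge c v w = Free v × Free w × Alt c true v w

  IncidentFree : Fin n → Set
  IncidentFree b = Free (inj₁ b) ⊎ Free (inj₂ (σ zero b))

  -- G' is (a copy of) G_{/H}: its black / white vertices are identified,
  -- via injections ιB / ιW, with the vertices of G that are outside H or free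
  -- in H; its color-0 edges are those of G (between the kept vertices); its
  -- edges of colors 1…d at vertices outside H are those of G; and at free
  -- vertices they are the edges of the boundary bubble ∂H.
  record IsContraction (G' : ColGraph d) : Set where
    private module G' = ColGraph G'
    field
      ιB      : Fin G'.n → Fin n
      ιW      : Fin G'.n → Fin n
      ιB-inj  : Injective _≡_ _≡_ ιB
      ιW-inj  : Injective _≡_ _≡_ ιW
      ιB-img  : ∀ b' → ¬ inV (inj₁ (ιB b')) ⊎ Free (inj₁ (ιB b'))
      ιW-img  : ∀ w' → ¬ inV (inj₂ (ιW w')) ⊎ Free (inj₂ (ιW w'))
      ιB-surj : ∀ b → (¬ inV (inj₁ b) ⊎ Free (inj₁ b)) → ∃ λ b' → ιB b' ≡ b
      ιW-surj : ∀ w → (¬ inV (inj₂ w) ⊎ Free (inj₂ w)) → ∃ λ w' → ιW w' ≡ w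
      edge-0    : ∀ b' → ιW (G'.σ zero b') ≡ σ zero (ιB b')
      edge-out  : ∀ b' (c : Fin d) → ¬ inV (inj₁ (ιB b'))
                  → ιW (G'.σ (suc c) b') ≡ σ (suc c) (ιB b')
      edge-bdry : ∀ b' (c : Fin d) → inV (inj₁ (ιB b'))
                  → BoundaryEdge c (inj₁ (ιB b')) (inj₂ (ιW (G'.σ (suc c) b')))

module Submission where

-- Fix c ∈ {1,…,d}.  Every vertex has exactly one edge of color 0 and one of
-- color c, so a walk alternating these colors is determined by its start.
-- (⇐) A {0,c}-edge of G_{/H} is either an edge of G, or a boundary edge,
--     i.e. an alternating 0/c path inside H; so G_{/H}-walks lift to G-walks.
-- (⇒) Follow a {0,c}-walk of G from a kept vertex.  Invariant: the current
--     vertex is a kept vertex reached in G_{/H}, or the end of an alternating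
--     walk inside H that starts with color c at a free vertex reached in
--     G_{/H}.  Alternating walks inside H are deterministic, so such a walk
--     that arrives at a free vertex after a c-edge is a boundary edge of ∂H.
--     Membership in H is undecidable, so "inside H" is tracked up to double
--     negation; this suffices because the walk leaves H only through kept
--     vertices, and being kept is decidable.

open import Defs
open import Data.Nat using (ℕ)
open import Data.Fin using (Fin; zero; suc; _≟_)
open import Data.Fin.Properties using (any?)
open import Function using (id)
open import Function.Bundles using (_⇔_; mk⇔)
open import Data.Sum using (_⊎_; inj₁; inj₂)
open import Data.Sum.Properties using (inj₁-injective; inj₂-injective)
open import Data.Product using (Σ; _×_; _,_; proj₁; proj₂)
open import Data.Bool using (Bool; true; false; not)
open import Data.Empty using (⊥-elim)
open import Relation.Nullary using (¬_; Dec; yes; no)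
open import Relation.Binary.PropositionalEquality using (_≡_; refl; sym; trans; cong; subst)
open import Relation.Nullary.Negation using (contradiction; ¬¬-map)
open import Relation.Binary.Construct.Closure.ReflexiveTransitive
  using (Star; ε; _◅_; _◅◅_; gmap; reverse)

Bicolor : ∀ {d} → Fin d → Color d → Set
Bicolor c a = a ≡ zero ⊎ a ≡ suc c

star-last : ∀ {A : Set} {T : A → A → Set} {i k} → Star T i k
          → i ≡ k ⊎ Σ A λ j → Star T i j × T j k
star-last ε = inj₁ refl
star-last (x ◅ xs) with star-last xs
... | inj₁ refl = inj₂ (_ , ε , x)
... | inj₂ (j , ys , y) = inj₂ (j , x ◅ ys , y)

module Matchings {d : ℕ} (G : ColGraph d) where
  open ColGraph G

  σ-injective : ∀ a {x y} → σ a x ≡ σ a y → x ≡ y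
  σ-injective a = proj₁ (σ-bij a)

  adj-sym : ∀ {R} {x y} → Adj G R x y → Adj G R y x
  adj-sym {x = inj₁ _} {inj₂ _} e = e
  adj-sym {x = inj₂ _} {inj₁ _} e = e
  adj-sym {x = inj₁ _} {inj₁ _} ()
  adj-sym {x = inj₂ _} {inj₂ _} ()

  adj-map : ∀ {R R' : Color d → Fin n → Set} → (∀ {a b} → R a b → R' a b)
          → ∀ {x y} → Adj G R x y → Adj G R' x y
  adj-map f {inj₁ _} {inj₂ _} (a , r , eq) = a , f r , eq
  adj-map f {inj₂ _} {inj₁ _} (a , r , eq) = a , f r , eq
  adj-map f {inj₁ _} {inj₁ _} ()
  adj-map f {inj₂ _} {inj₂ _} ()

  ColorEdge : Color d → Vertex G → Vertex G → Set
  ColorEdge a = Adj G (λ a' _ → a' ≡ a)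

  BicolorEdge : Fin d → Vertex G → Vertex G → Set
  BicolorEdge c = Adj G (λ a _ → Bicolor c a)

  color-neighbour-unique : ∀ {a x y y'} → ColorEdge a x y → ColorEdge a x y' → y ≡ y'
  color-neighbour-unique {x = inj₁ _} {inj₂ _} {inj₂ _} (_ , refl , e) (_ , refl , e') =
    cong inj₂ (trans (sym e) e')
  color-neighbour-unique {a} {x = inj₂ _} {inj₁ _} {inj₁ _} (_ , refl , e) (_ , refl , e') =
    cong inj₁ (σ-injective a (trans e (sym e')))
  color-neighbour-unique {x = inj₁ _} {inj₁ _} () _
  color-neighbour-unique {x = inj₂ _} {inj₂ _} () _
  color-neighbour-unique {x = inj₁ _} {inj₂ _} {inj₁ _} _ ()
  color-neighbour-unique {x = inj₂ _} {inj₁ _} {inj₂ _} _ ()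

  bicolor-edge-split : ∀ {c x y} → BicolorEdge c x y → ColorEdge zero x y ⊎ ColorEdge (suc c) x y
  bicolor-edge-split {x = inj₁ _} {inj₂ _} (a , inj₁ refl , eq) = inj₁ (a , refl , eq)
  bicolor-edge-split {x = inj₁ _} {inj₂ _} (a , inj₂ refl , eq) = inj₂ (a , refl , eq)
  bicolor-edge-split {x = inj₂ _} {inj₁ _} (a , inj₁ refl , eq) = inj₁ (a , refl , eq)
  bicolor-edge-split {x = inj₂ _} {inj₁ _} (a , inj₂ refl , eq) = inj₂ (a , refl , eq)
  bicolor-edge-split {x = inj₁ _} {inj₁ _} ()
  bicolor-edge-split {x = inj₂ _} {inj₂ _} ()

module AlternatingWalks {d : ℕ} {G : ColGraph d} (H : ColSubgraph G) (c : Fin d) where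
  open ColSubgraph H
  open Matchings G

  -- an edge of color a not provably outside H (membership is undecidable)
  WeakHEdge : Color d → Vertex G → Vertex G → Set
  WeakHEdge a = Adj G (λ a' b → a' ≡ a × ¬ ¬ inE a' b)

  -- a vertex together with the color of the next edge: true = c, false = 0
  State : Set
  State = Vertex G × Bool

  data AltStep : State → State → Set where
    step-c : ∀ {v w} → WeakHEdge (suc c) v w → AltStep (v , true) (w , false)
    step-0 : ∀ {v w} → WeakHEdge zero v w → AltStep (v , false) (w , true)

  AltWalk : State → State → Set
  AltWalk = Star AltStep

  weak-edge-target-in-H : ∀ {a x y} → WeakHEdge a x y → ¬ ¬ inV y
  weak-edge-target-in-H {x = inj₁ b} {inj₂ _} (_ , (refl , nn) , eq) =
    ¬¬-map (λ ie → subst (λ w → inV (inj₂ w)) eq (proj₂ (edge-ends _ b ie))) nn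
  weak-edge-target-in-H {x = inj₂ _} {inj₁ b} (_ , (refl , nn) , _) =
    ¬¬-map (λ ie → proj₁ (edge-ends _ b ie)) nn
  weak-edge-target-in-H {x = inj₁ _} {inj₁ _} ()
  weak-edge-target-in-H {x = inj₂ _} {inj₂ _} ()

  weak-0-edge-target-has0 : ∀ {x y} → WeakHEdge zero x y → ¬ ¬ Has0 H y
  weak-0-edge-target-has0 {inj₁ b} {inj₂ _} (_ , (refl , nn) , eq) = ¬¬-map (λ ie → b , eq , ie) nn
  weak-0-edge-target-has0 {inj₂ _} {inj₁ _} (_ , (refl , nn) , _) = nn
  weak-0-edge-target-has0 {inj₁ _} {inj₁ _} ()
  weak-0-edge-target-has0 {inj₂ _} {inj₂ _} ()

  walk-stays-in-H : ∀ {i j} → ¬ ¬ inV (proj₁ i) → AltWalk i j → ¬ ¬ inV (proj₁ j)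
  walk-stays-in-H nn ε = nn
  walk-stays-in-H _ (step-c e ◅ w) = walk-stays-in-H (weak-edge-target-in-H e) w
  walk-stays-in-H _ (step-0 e ◅ w) = walk-stays-in-H (weak-edge-target-in-H e) w

  walk-after-0 : ∀ {i v} → AltWalk i (v , true) → i ≡ (v , true) ⊎ ¬ ¬ Has0 H v
  walk-after-0 ε = inj₁ refl
  walk-after-0 (s ◅ w) with walk-after-0 w
  ... | inj₂ h = inj₂ h
  walk-after-0 (step-0 e ◅ w) | inj₁ refl = inj₂ (weak-0-edge-target-has0 e)

  c-edge-in-H : ∀ {v v'} → ¬ ¬ inV v → ColorEdge (suc c) v v' → WeakHEdge (suc c) v v'
  c-edge-in-H {inj₁ b} {inj₂ _} nn (_ , refl , eq) =
    suc c , (refl , ¬¬-map (full-black b c) nn) , eq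
  c-edge-in-H {inj₂ _} {inj₁ b} nn (_ , refl , eq) =
    suc c , (refl , ¬¬-map (λ iv → full-white b c (subst (λ z → inV (inj₂ z)) (sym eq) iv)) nn) , eq
  c-edge-in-H {inj₁ _} {inj₁ _} _ ()
  c-edge-in-H {inj₂ _} {inj₂ _} _ ()

  0-edge-in-H : ∀ {v v'} → ¬ ¬ Has0 H v → ColorEdge zero v v' → WeakHEdge zero v v'
  0-edge-in-H {inj₁ _} {inj₂ _} h (_ , refl , eq) = zero , (refl , h) , eq
  0-edge-in-H {inj₂ w} {inj₁ b} h (_ , refl , eq) = zero , (refl , ¬¬-map from-b h) , eq
    where
      from-b : Has0 H (inj₂ w) → inE zero b
      from-b (_ , e , ie) = subst (inE zero) (σ-injective zero (trans e (sym eq))) ie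
  0-edge-in-H {inj₁ _} {inj₁ _} _ ()
  0-edge-in-H {inj₂ _} {inj₂ _} _ ()

  flip-state : State → State
  flip-state (v , t) = v , not t

  reverse-walk : ∀ {i j} → AltWalk i j → AltWalk (flip-state j) (flip-state i)
  reverse-walk w = gmap flip-state id (reverse reverse-step w)
    where
      reverse-step : ∀ {i j} → AltStep i j → AltStep (flip-state j) (flip-state i)
      reverse-step (step-c e) = step-c (adj-sym e)
      reverse-step (step-0 e) = step-0 (adj-sym e)

  parity : State → Bool
  parity (inj₁ _ , t) = not t
  parity (inj₂ _ , t) = t

  walk-parity : ∀ {i j} → AltWalk i j → parity i ≡ parity j
  walk-parity ε = refl
  walk-parity (s ◅ w) = trans (step-parity s) (walk-parity w)
    where
      step-parity : ∀ {i j} → AltStep i j → parity i ≡ parity j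
      step-parity (step-c {inj₁ _} {inj₂ _} _) = refl
      step-parity (step-c {inj₂ _} {inj₁ _} _) = refl
      step-parity (step-c {inj₁ _} {inj₁ _} ())
      step-parity (step-c {inj₂ _} {inj₂ _} ())
      step-parity (step-0 {inj₁ _} {inj₂ _} _) = refl
      step-parity (step-0 {inj₂ _} {inj₁ _} _) = refl
      step-parity (step-0 {inj₁ _} {inj₁ _} ())
      step-parity (step-0 {inj₂ _} {inj₂ _} ())

  alt-to-walk : ∀ {t v w} → Alt H c t v w → Σ Bool λ s → AltWalk (v , t) (w , s)
  alt-to-walk (one {t} e) = not t , step t e ◅ ε
    where
      step : ∀ t {v w} → HEdge H (col H c t) v w → AltStep (v , t) (w , not t)
      step true e = step-c (adj-map (λ { (eq , ie) → eq , contradiction ie }) e)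
      step false e = step-0 (adj-map (λ { (eq , ie) → eq , contradiction ie }) e)
  alt-to-walk (cons e r) with alt-to-walk r
  ... | s , w = s , proj₂ (alt-to-walk (one e)) ◅◅ w

  -- the path of a boundary edge ends after a c-edge, since its end is free
  boundary-walk : ∀ {b w} → Alt H c true (inj₁ b) (inj₂ w) → Free H (inj₂ w)
                → AltWalk (inj₁ b , true) (inj₂ w , false)
  boundary-walk a free with alt-to-walk a
  ... | false , w = w
  ... | true , w with walk-after-0 w
  ...   | inj₁ ()
  ...   | inj₂ h = ⊥-elim (h (proj₂ free))

  walk-deterministic : ∀ {i v v'} → AltWalk i (v , false) → AltWalk i (v' , false)
                     → Free H v → Free H v' → v ≡ v'
  walk-deterministic ε ε _ _ = refl
  walk-deterministic ε (step-0 e ◅ _) fv _ = ⊥-elim (weak-0-edge-target-has0 (adj-sym e) (proj₂ fv))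
  walk-deterministic (step-0 e ◅ _) ε _ fv' = ⊥-elim (weak-0-edge-target-has0 (adj-sym e) (proj₂ fv'))
  walk-deterministic (step-c e ◅ w) (step-c e' ◅ w') fv fv'
    with color-neighbour-unique (adj-map proj₁ e) (adj-map proj₁ e')
  ... | refl = walk-deterministic w w' fv fv'
  walk-deterministic (step-0 e ◅ w) (step-0 e' ◅ w') fv fv'
    with color-neighbour-unique (adj-map proj₁ e) (adj-map proj₁ e')
  ... | refl = walk-deterministic w w' fv fv'

module Embedding {d : ℕ} {G : ColGraph d} {H : ColSubgraph G} {G' : ColGraph d}
                 (C : IsContraction H G') where
  open ColSubgraph H
  open IsContraction C

  embed : Vertex G' → Vertex G
  embed (inj₁ b) = inj₁ (ιB b)
  embed (inj₂ w) = inj₂ (ιW w)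

  embed-injective : ∀ {x y} → embed x ≡ embed y → x ≡ y
  embed-injective {inj₁ _} {inj₁ _} eq = cong inj₁ (ιB-inj (inj₁-injective eq))
  embed-injective {inj₂ _} {inj₂ _} eq = cong inj₂ (ιW-inj (inj₂-injective eq))
  embed-injective {inj₁ _} {inj₂ _} ()
  embed-injective {inj₂ _} {inj₁ _} ()

  Kept : Vertex G → Set
  Kept v = Σ (Vertex G') λ y → embed y ≡ v

  kept-status : (y : Vertex G') → ¬ inV (embed y) ⊎ Free H (embed y)
  kept-status (inj₁ b) = ιB-img b
  kept-status (inj₂ w) = ιW-img w

  free-is-kept : ∀ {v} → Free H v → Kept v
  free-is-kept {inj₁ b} f with ιB-surj b (inj₂ f)
  ... | b' , eq = inj₁ b' , cong inj₁ eq
  free-is-kept {inj₂ w} f with ιW-surj w (inj₂ f)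
  ... | w' , eq = inj₂ w' , cong inj₂ eq

  -- being kept is decidable (finite search), unlike membership in H
  kept? : (v : Vertex G) → Dec (Kept v)
  kept? (inj₁ b) with any? (λ b' → ιB b' ≟ b)
  ... | yes (b' , eq) = yes (inj₁ b' , cong inj₁ eq)
  ... | no k = no λ { (inj₁ b' , refl) → k (b' , refl) ; (inj₂ _ , ()) }
  kept? (inj₂ w) with any? (λ w' → ιW w' ≟ w)
  ... | yes (w' , eq) = yes (inj₂ w' , cong inj₂ eq)
  ... | no k = no λ { (inj₂ w' , refl) → k (w' , refl) ; (inj₁ _ , ()) }

module Comparison {d : ℕ} {G : ColGraph d} {H : ColSubgraph G} {G' : ColGraph d}
                  (C : IsContraction H G') (c : Fin d) where
  open ColSubgraph H
  open IsContraction C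
  open Matchings G
  open AlternatingWalks H c
  open Embedding C
  private module G' = ColGraph G'
  open Matchings G' using () renaming (BicolorEdge to BicolorEdge')

  Walk : Vertex G → Vertex G → Set
  Walk = Star (BicolorEdge c)

  Walk' : Vertex G' → Vertex G' → Set
  Walk' = Star (BicolorEdge' c)

  alt-is-walk : ∀ {t u w} → Alt H c t u w → Walk u w
  alt-is-walk (one {t} e) = adj-map (λ { (eq , _) → col-bicolor t eq }) e ◅ ε
    where
      col-bicolor : ∀ t {a} → a ≡ col H c t → Bicolor c a
      col-bicolor true eq = inj₂ eq
      col-bicolor false eq = inj₁ eq
  alt-is-walk (cons e r) = alt-is-walk (one e) ◅◅ alt-is-walk r

  edge'-from-black : ∀ b' a → Bicolor c a → Walk (inj₁ (ιB b')) (inj₂ (ιW (G'.σ a b')))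
  edge'-from-black b' _ (inj₁ refl) = (zero , inj₁ refl , sym (edge-0 b')) ◅ ε
  edge'-from-black b' _ (inj₂ refl) with ιB-img b'
  ... | inj₁ outside = (suc c , inj₂ refl , sym (edge-out b' c outside)) ◅ ε
  ... | inj₂ free with edge-bdry b' c (proj₁ free)
  ... | _ , _ , path = alt-is-walk path

  edge'-to-walk : ∀ {x y} → BicolorEdge' c x y → Walk (embed x) (embed y)
  edge'-to-walk {inj₁ b'} {inj₂ _} (a , pa , eq) =
    subst (λ z → Walk (inj₁ (ιB b')) (inj₂ (ιW z))) eq (edge'-from-black b' a pa)
  edge'-to-walk {inj₂ _} {inj₁ b'} (a , pa , eq) =
    reverse adj-sym (subst (λ z → Walk (inj₁ (ιB b')) (inj₂ (ιW z))) eq (edge'-from-black b' a pa))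
  edge'-to-walk {inj₁ _} {inj₁ _} ()
  edge'-to-walk {inj₂ _} {inj₂ _} ()

  walk'-to-walk : ∀ {x y} → Walk' x y → Walk (embed x) (embed y)
  walk'-to-walk ε = ε
  walk'-to-walk (s ◅ w) = edge'-to-walk s ◅◅ walk'-to-walk w

  walk-is-boundary-edge : ∀ x y → Free H (embed x) → Free H (embed y)
                        → AltWalk (embed x , true) (embed y , false) → BicolorEdge' c x y
  walk-is-boundary-edge (inj₁ b') y fx fy W with edge-bdry b' c (proj₁ fx)
  ... | _ , fw , path with walk-deterministic (boundary-walk path fw) W fw fy
  walk-is-boundary-edge (inj₁ b') (inj₂ w) fx fy W | _ , fw , path | eq =
    suc c , inj₂ refl , ιW-inj (inj₂-injective eq)
  walk-is-boundary-edge (inj₁ b') (inj₁ _) fx fy W | _ , fw , path | ()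
  walk-is-boundary-edge (inj₂ w') (inj₂ _) fx fy W with walk-parity W
  ... | ()
  walk-is-boundary-edge (inj₂ w') (inj₁ b) fx fy W with edge-bdry b c (proj₁ fy)
  ... | _ , fw , path with walk-deterministic (boundary-walk path fw) (reverse-walk W) fw fx
  ... | eq = suc c , inj₂ refl , ιW-inj (inj₂-injective eq)

  lift-0-edge : ∀ {v} (x : Vertex G') → ColorEdge zero (embed x) v
              → Σ (Vertex G') λ y → BicolorEdge' c x y × embed y ≡ v
  lift-0-edge {inj₂ _} (inj₁ b') (_ , refl , eq) =
    inj₂ (G'.σ zero b') , (zero , inj₁ refl , refl) , cong inj₂ (trans (edge-0 b') eq)
  lift-0-edge {inj₁ _} (inj₂ w') (_ , refl , eq) with proj₂ (G'.σ-bij zero) w'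
  ... | b'' , onto = inj₁ b'' , (zero , inj₁ refl , onto refl) ,
        cong inj₁ (sym (σ-injective zero
          (trans eq (sym (trans (sym (edge-0 b'')) (cong ιW (onto refl)))))))
  lift-0-edge {inj₁ _} (inj₁ _) ()
  lift-0-edge {inj₂ _} (inj₂ _) ()

  lift-c-edge : ∀ {v} (x : Vertex G') → ¬ inV (embed x) → ColorEdge (suc c) (embed x) v
              → Σ (Vertex G') λ y → BicolorEdge' c x y × embed y ≡ v
  lift-c-edge {inj₂ _} (inj₁ b') outside (_ , refl , eq) =
    inj₂ (G'.σ (suc c) b') , (suc c , inj₂ refl , refl) , cong inj₂ (trans (edge-out b' c outside) eq)
  lift-c-edge {inj₁ _} (inj₂ w') outside (_ , refl , eq) with proj₂ (G'.σ-bij (suc c)) w'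
  ... | b'' , onto with ιB-img b''
  ... | inj₁ outside'' = inj₁ b'' , (suc c , inj₂ refl , onto refl) ,
        cong inj₁ (sym (σ-injective (suc c)
          (trans eq (sym (trans (sym (edge-out b'' c outside'')) (cong ιW (onto refl)))))))
  -- a free neighbour b'' would put its boundary-edge end w' inside H
  ... | inj₂ free'' with edge-bdry b'' c (proj₁ free'')
  ... | _ , fw , _ = ⊥-elim (outside (subst (λ z → inV (inj₂ (ιW z))) (onto refl) (proj₁ fw)))
  lift-c-edge {inj₁ _} (inj₁ _) _ ()
  lift-c-edge {inj₂ _} (inj₂ _) _ ()

  module Forward (start : Vertex G') where

    Reached : Vertex G' → Set
    Reached = Walk' start

    data Tracked (v : Vertex G) : Set where
      kept   : ∀ {y} → Reached y → embed y ≡ v → Tracked v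
      inside : ∀ {x s} → Reached x → Free H (embed x)
             → AltWalk (embed x , true) (v , s) → Tracked v

    inside-at-kept : ∀ {x v s} → Reached x → Free H (embed x)
                   → AltWalk (embed x , true) (v , s) → (y : Vertex G') → embed y ≡ v → Reached y
    inside-at-kept r fx W y refl with kept-status y
    ... | inj₁ outside = ⊥-elim (walk-stays-in-H (contradiction (proj₁ fx)) W outside)
    inside-at-kept {x} {s = false} r fx W y refl | inj₂ fy =
      r ◅◅ (walk-is-boundary-edge x y fx fy W ◅ ε)
    inside-at-kept {s = true} r fx W y refl | inj₂ fy with walk-after-0 W
    ... | inj₂ has0 = ⊥-elim (has0 (proj₂ fy))
    ... | inj₁ eq = subst Reached (embed-injective (cong proj₁ eq)) r

    step-from-kept : ∀ {x v} → Reached x → BicolorEdge c (embed x) v → Tracked v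
    step-from-kept {x} r e with bicolor-edge-split e
    ... | inj₁ e0 with lift-0-edge x e0
    ...   | y , e' , eq = kept (r ◅◅ (e' ◅ ε)) eq
    step-from-kept {x} r e | inj₂ ec with kept-status x
    ... | inj₂ fx = inside r fx (step-c (c-edge-in-H (contradiction (proj₁ fx)) ec) ◅ ε)
    ... | inj₁ outside with lift-c-edge x outside ec
    ...   | y , e' , eq = kept (r ◅◅ (e' ◅ ε)) eq

    -- a step from the end of an inside walk extends the walk, undoes its last
    -- edge, or leaves H through a kept (hence free) vertex
    step-inside : ∀ {x v v'} s → Reached x → Free H (embed x)
                → AltWalk (embed x , true) (v , s) → BicolorEdge c v v' → Tracked v'
    step-inside true r fx W e with bicolor-edge-split e
    ... | inj₂ ec =
      inside r fx (W ◅◅ (step-c (c-edge-in-H (walk-stays-in-H (contradiction (proj₁ fx)) W) ec) ◅ ε))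
    ... | inj₁ e0 with star-last W
    ...   | inj₁ eq = step-from-kept r (subst (λ u → BicolorEdge c u _) (sym (cong proj₁ eq)) e)
    ...   | inj₂ (_ , W' , step-0 e') with color-neighbour-unique (adj-map proj₁ (adj-sym e')) e0
    ...     | refl = inside r fx W'
    step-inside false r fx W e with bicolor-edge-split e
    ... | inj₂ ec with star-last W
    ...   | inj₁ ()
    ...   | inj₂ (_ , W' , step-c e') with color-neighbour-unique (adj-map proj₁ (adj-sym e')) ec
    ...     | refl = inside r fx W'
    step-inside {v = v} false r fx W e | inj₁ e0 with kept? v
    ... | yes (y , eq) =
      step-from-kept (inside-at-kept r fx W y eq) (subst (λ u → BicolorEdge c u _) (sym eq) e)
    ... | no not-kept = inside r fx (W ◅◅ (step-0 (0-edge-in-H has0 e0) ◅ ε))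
      where
        -- v lies in H but is not kept, hence not free
        has0 : ¬ ¬ Has0 H v
        has0 k = walk-stays-in-H (contradiction (proj₁ fx)) W (λ iv → not-kept (free-is-kept (iv , k)))

    track : ∀ {u v} → Tracked u → Walk u v → Tracked v
    track t ε = t
    track (kept r refl) (e ◅ w) = track (step-from-kept r e) w
    track (inside {s = s} r fx W) (e ◅ w) = track (step-inside s r fx W e) w

    walk-to-walk' : ∀ {y} → Walk (embed start) (embed y) → Reached y
    walk-to-walk' {y} w with track (kept ε refl) w
    ... | kept r eq = subst Reached (embed-injective eq) r
    ... | inside r fx W = inside-at-kept r fx W y refl

contraction-preserves-I : ∀ {d} {G : ColGraph d} {H : ColSubgraph G} {G' : ColGraph d}
                          (C : IsContraction H G') b₁ b₂ c
                        → InI G (IsContraction.ιB C b₁) (IsContraction.ιB C b₂) c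
                          ⇔ InI G' b₁ b₂ c
contraction-preserves-I C b₁ b₂ c = mk⇔ walk-to-walk' walk'-to-walk
  where
    open Comparison C c
    open Forward (inj₁ b₁)

proposition4 : ∀ {d : ℕ} (G : ColGraph d) → Connected G
    → (H : ColSubgraph G) (G' : ColGraph d) (C : IsContraction H G')
    → ∀ b₁ b₂
    → IncidentFree H (IsContraction.ιB C b₁)
    → IncidentFree H (IsContraction.ιB C b₂)
    → ∀ (c : Fin d)
    → InI G (IsContraction.ιB C b₁) (IsContraction.ιB C b₂) c ⇔ InI G' b₁ b₂ c
proposition4 _ _ _ _ C b₁ b₂ _ _ = contraction-preserves-I C b₁ b₂
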